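{- Let $E$ be an arbitrary set and $\mathscr L\subseteq\{+,-,0\}^E$. Then $\mathscr L$ satisfies the four axioms (C), (FS), (SE$^=$), (P$^=_{\mathrm{asym}}$) below (i.e. $\mathscr L$ is the set of covectors of an affine oriented matroid) if and only if $\mathscr L$ satisfies the three axioms (FS) $\mathscr L\circ(-\mathscr L)\subseteq\mathscr L$; (SE) for all $X,Y\in\mathscr L$ and all $e\in S(X,Y)$, $I_e(X,Y)\neq\emptyset$; (P) $\mathcal P(\mathscr L)\circ\mathscr L\subseteq\mathscr L$. The axioms (C), (SE$^=$), (P$^=_{\mathrm{asym}}$) are: (C) $\mathscr L\circ\mathscr L\subseteq\mathscr L$; (SE$^=$) for all $X,Y\in\mathscr L$ with $\underline X=\underline Y$ and all $e\in S(X,Y)$, $I^=_e(X,Y)\neq\emptyset$; (P$^=_{\mathrm{asym}}$) $\mathcal P^=_{\mathrm{asym}}(\mathscr L)\circ\mathscr L\subseteq\mathscr L$.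
   Context: A sign vector on $E$ is a map $X:E\to\{+,-,0\}$; $-X$ is its negative, $\underline X=\{e:X(e)\neq0\}$ its support. For sign vectors $X,Y$: the separator is $S(X,Y)=\{e\in\underline X\cap\underline Y: X(e)\neq Y(e)\}$; the composition is $(X\circ Y)(e)=X(e)$ if $X(e)\neq 0$ and $Y(e)$ otherwise; $(X\oplus Y)(e)=0$ if $e\in S(X,Y)$ and $(X\circ Y)(e)$ otherwise. For sets $\mathcal A,\mathcal B$ of sign vectors, $\mathcal A\circ\mathcal B=\{X\circ Y:X\in\mathcal A,Y\in\mathcal B\}$ and $-\mathcal B=\{ -Y:Y\in\mathcal B\}$. For $\mathscr L$, sign vectors $X,Y$ and $e\in E$: $I_e(X,Y)=\{Z\in\mathscr L: Z(e)=0,\ Z(f)=(X\circ Y)(f)\ \forall f\notin S(X,Y)\}$, $I(X,Y)=\bigcup_{e\in S(X,Y)}I_e(X,Y)$; $I^=_e(X,Y)=\{Z\in\mathscr L: Z(e)=0,\ Z(f)=X(f)\ \forall f\notin S(X,Y)\}$, $I^=(X,Y)=\bigcup_{e\in S(X,Y)}I^=_e(X,Y)$; $\mathcal P(\mathscr L)=\{X\oplus(-Y): X,Y\in\mathscr L,\ I(X,-Y)=I(-X,Y)=\emptyset\}$; $\mathrm{Asym}(\mathscr L)=\{X\in\mathscr L: -X\notin\mathscr L\}$; $\mathcal P^=_{\mathrm{asym}}(\mathscr L)=\{X\oplus(-Y): X,Y\in\mathrm{Asym}(\mathscr L),\ \underline X=\underline Y,\ I^=(X,-Y)=I^=(-X,Y)=\emptyset\}$.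 -}

module Defs where

open import Data.Bool using (Bool; true; false)
open import Data.Product using (Σ; Σ-syntax; _×_; ∃; ∃-syntax)
open import Relation.Nullary using (¬_)
open import Relation.Binary.PropositionalEquality using (_≡_)

data Sign : Set where
  ⊕ ⊖ 𝟘 : Sign

SignVec : Set → Set
SignVec E = E → Sign

negS : Sign → Sign
negS ⊕ = ⊖
negS ⊖ = ⊕
negS 𝟘 = 𝟘

neg : {E : Set} → SignVec E → SignVec E
neg X e = negS (X e)

InSupp : {E : Set} → SignVec E → E → Set
InSupp X e = ¬ (X e ≡ 𝟘)

SameSupp : {E : Set} → SignVec E → SignVec E → Set
SameSupp X Y = ∀ e → (InSupp X e → InSupp Y e) × (InSupp Y e → InSupp X e)

sepS : Sign → Sign → Bool
sepS ⊕ ⊖ = true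
sepS ⊖ ⊕ = true
sepS _ _ = false

InSep : {E : Set} → SignVec E → SignVec E → E → Set
InSep X Y e = sepS (X e) (Y e) ≡ true

compS : Sign → Sign → Sign
compS 𝟘 b = b
compS a _ = a

_∘ₛ_ : {E : Set} → SignVec E → SignVec E → SignVec E
(X ∘ₛ Y) e = compS (X e) (Y e)

oplusS : Sign → Sign → Sign
oplusS a b with sepS a b
... | true = 𝟘
... | false = compS a b

_⊕ₛ_ : {E : Set} → SignVec E → SignVec E → SignVec E
(X ⊕ₛ Y) e = oplusS (X e) (Y e)

_≗ₛ_ : {E : Set} → SignVec E → SignVec E → Set
X ≗ₛ Y = ∀ e → X e ≡ Y e

SVSet : Set → Set₁
SVSet E = SignVec E → Set

module _ {E : Set} (L : SVSet E) where

  Iₑ : SignVec E → SignVec E → E → SignVec E → Set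
  Iₑ X Y e Z = L Z × (Z e ≡ 𝟘) × (∀ f → ¬ InSep X Y f → Z f ≡ (X ∘ₛ Y) f)

  I⁼ₑ : SignVec E → SignVec E → E → SignVec E → Set
  I⁼ₑ X Y e Z = L Z × (Z e ≡ 𝟘) × (∀ f → ¬ InSep X Y f → Z f ≡ X f)

  IEmpty : SignVec E → SignVec E → Set
  IEmpty X Y = ¬ (Σ[ e ∈ E ] Σ[ Z ∈ SignVec E ] (InSep X Y e × Iₑ X Y e Z))

  I⁼Empty : SignVec E → SignVec E → Set
  I⁼Empty X Y = ¬ (Σ[ e ∈ E ] Σ[ Z ∈ SignVec E ] (InSep X Y e × I⁼ₑ X Y e Z))

  InP : SignVec E → Set
  InP Z = Σ[ X ∈ SignVec E ] Σ[ Y ∈ SignVec E ]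
            (L X × L Y × IEmpty X (neg Y) × IEmpty (neg X) Y × (Z ≗ₛ (X ⊕ₛ neg Y)))

  InAsym : SignVec E → Set
  InAsym X = L X × ¬ L (neg X)

  InP⁼asym : SignVec E → Set
  InP⁼asym Z = Σ[ X ∈ SignVec E ] Σ[ Y ∈ SignVec E ]
            (InAsym X × InAsym Y × SameSupp X Y
              × I⁼Empty X (neg Y) × I⁼Empty (neg X) Y × (Z ≗ₛ (X ⊕ₛ neg Y)))

  AxC : Set
  AxC = ∀ X Y → L X → L Y → L (X ∘ₛ Y)

  AxFS : Set
  AxFS = ∀ X Y → L X → L Y → L (X ∘ₛ neg Y)

  AxSE : Set
  AxSE = ∀ X Y → L X → L Y → ∀ e → InSep X Y e → ∃[ Z ] Iₑ X Y e Z

  AxSE⁼ : Set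
  AxSE⁼ = ∀ X Y → L X → L Y → SameSupp X Y → ∀ e → InSep X Y e → ∃[ Z ] I⁼ₑ X Y e Z

  AxP : Set
  AxP = ∀ Z W → InP Z → L W → L (Z ∘ₛ W)

  AxP⁼asym : Set
  AxP⁼asym = ∀ Z W → InP⁼asym Z → L W → L (Z ∘ₛ W)

  -- L is a genuine subset of {+,-,0}^E: membership respects equality of maps
  Extensional : Set
  Extensional = ∀ X Y → X ≗ₛ Y → L X → L Y

-- Everything rests on two observations. First, I_e(X,Y) and I⁼_e(X,Y) only depend on the
-- separator S(X,Y) and on the sign vector the members must agree with off it (X ∘ Y resp. X);
-- when supp Y ⊆ supp X these targets coincide, so (SE) and (SE⁼), (P) and (P⁼asym) agree on
-- vectors of equal support. Second, for X, Y ∈ L the vectors X' = X ∘ -Y and Y' = Y ∘ -X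
-- lie in L by (FS), have equal support, satisfy X' ⊕ -Y' = X ⊕ -Y, and I⁼(X',-Y') = I(X,-Y),
-- I⁼(-X',Y') = I(-X,Y). If these are empty and S(X,-Y) ≠ ∅, then X', Y' are asymmetric, since
-- -X' ∈ L (or -Y' ∈ L) would make one of them nonempty by (SE). This turns (P⁼asym) into (P);
-- (C) follows from (FS) because X ∘ Y = X ∘ -(X ∘ -Y).
module Submission where

open import Defs
open import Axiom.ExcludedMiddle using (ExcludedMiddle)
open import Data.Bool using (Bool; true; false)
open import Data.Empty using (⊥-elim)
open import Data.Product using (_×_; _,_; proj₂; Σ-syntax; ∃-syntax)
open import Function.Base using (_∘_)
open import Function.Bundles using (_⇔_; mk⇔)
open import Level using (0ℓ)
open import Relation.Nullary using (¬_; yes; no)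
open import Relation.Binary.PropositionalEquality
  using (_≡_; _≗_; refl; sym; trans; cong; module ≡-Reasoning)

negS-involutive : ∀ a → negS (negS a) ≡ a
negS-involutive ⊕ = refl
negS-involutive ⊖ = refl
negS-involutive 𝟘 = refl

negS-≡𝟘 : ∀ {a} → negS a ≡ 𝟘 → a ≡ 𝟘
negS-≡𝟘 {𝟘} _ = refl
negS-≡𝟘 {⊕} ()
negS-≡𝟘 {⊖} ()

negS-compS-negS : ∀ a b → negS (compS a (negS b)) ≡ compS (negS a) b
negS-compS-negS ⊕ _ = refl
negS-compS-negS ⊖ _ = refl
negS-compS-negS 𝟘 b = negS-involutive b

compS-negS-compS : ∀ a b → compS a (negS (compS a (negS b))) ≡ compS a b
compS-negS-compS ⊕ _ = refl
compS-negS-compS ⊖ _ = refl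
compS-negS-compS 𝟘 b = negS-involutive b

negS-≢𝟘 : ∀ {a} → ¬ a ≡ 𝟘 → ¬ negS a ≡ 𝟘
negS-≢𝟘 a≢𝟘 = a≢𝟘 ∘ negS-≡𝟘

negS-≢𝟘⁻¹ : ∀ {a} → ¬ negS a ≡ 𝟘 → ¬ a ≡ 𝟘
negS-≢𝟘⁻¹ -a≢𝟘 = -a≢𝟘 ∘ cong negS

compS-absorbˡ : ∀ a b → (¬ b ≡ 𝟘 → ¬ a ≡ 𝟘) → compS a b ≡ a
compS-absorbˡ ⊕ _ _ = refl
compS-absorbˡ ⊖ _ _ = refl
compS-absorbˡ 𝟘 𝟘 _ = refl
compS-absorbˡ 𝟘 ⊕ b⊆a = ⊥-elim (b⊆a (λ ()) refl)
compS-absorbˡ 𝟘 ⊖ b⊆a = ⊥-elim (b⊆a (λ ()) refl)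

compS-≡𝟘-comm : ∀ a b → compS a b ≡ 𝟘 → compS b a ≡ 𝟘
compS-≡𝟘-comm 𝟘 𝟘 _ = refl
compS-≡𝟘-comm ⊕ _ ()
compS-≡𝟘-comm ⊖ _ ()
compS-≡𝟘-comm 𝟘 ⊕ ()
compS-≡𝟘-comm 𝟘 ⊖ ()

compS-negS-≡𝟘-swap : ∀ a b → compS b (negS a) ≡ 𝟘 → compS a (negS b) ≡ 𝟘
compS-negS-≡𝟘-swap a b ba≡𝟘 = negS-≡𝟘 (trans (negS-compS-negS a b) (compS-≡𝟘-comm b (negS a) ba≡𝟘))

sepS-negˡ : ∀ a b → sepS (negS a) b ≡ sepS a (negS b)
sepS-negˡ ⊕ ⊕ = refl
sepS-negˡ ⊕ ⊖ = refl
sepS-negˡ ⊕ 𝟘 = refl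
sepS-negˡ ⊖ ⊕ = refl
sepS-negˡ ⊖ ⊖ = refl
sepS-negˡ ⊖ 𝟘 = refl
sepS-negˡ 𝟘 _ = refl

sepS-compS-comm : ∀ a b → sepS (compS a b) (compS b a) ≡ sepS a b
sepS-compS-comm ⊕ ⊕ = refl
sepS-compS-comm ⊕ ⊖ = refl
sepS-compS-comm ⊕ 𝟘 = refl
sepS-compS-comm ⊖ ⊕ = refl
sepS-compS-comm ⊖ ⊖ = refl
sepS-compS-comm ⊖ 𝟘 = refl
sepS-compS-comm 𝟘 ⊕ = refl
sepS-compS-comm 𝟘 ⊖ = refl
sepS-compS-comm 𝟘 𝟘 = refl

oplusS-negS-compS : ∀ a b →
  oplusS a (negS b) ≡ oplusS (compS a (negS b)) (negS (compS b (negS a)))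
oplusS-negS-compS ⊕ ⊕ = refl
oplusS-negS-compS ⊕ ⊖ = refl
oplusS-negS-compS ⊕ 𝟘 = refl
oplusS-negS-compS ⊖ ⊕ = refl
oplusS-negS-compS ⊖ ⊖ = refl
oplusS-negS-compS ⊖ 𝟘 = refl
oplusS-negS-compS 𝟘 ⊕ = refl
oplusS-negS-compS 𝟘 ⊖ = refl
oplusS-negS-compS 𝟘 𝟘 = refl

oplusS-noSep : ∀ a b → ¬ sepS a b ≡ true → oplusS a b ≡ compS a b
oplusS-noSep a b a∉b with sepS a b
... | true = ⊥-elim (a∉b refl)
... | false = refl

module _ {E : Set} where

  sep : SignVec E → SignVec E → E → Bool
  sep X Y f = sepS (X f) (Y f)

  _⊆supp_ : SignVec E → SignVec E → Set
  Y ⊆supp X = ∀ f → InSupp Y f → InSupp X f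

  zeros⇒SameSupp : ∀ X Y → (∀ (f : E) → X f ≡ 𝟘 → Y f ≡ 𝟘) → (∀ f → Y f ≡ 𝟘 → X f ≡ 𝟘) →
    SameSupp X Y
  zeros⇒SameSupp _ _ X→Y Y→X f = (λ X≢𝟘 → X≢𝟘 ∘ Y→X f) , (λ Y≢𝟘 → Y≢𝟘 ∘ X→Y f)

  ∘ₛ-absorbˡ : ∀ {X Y} → Y ⊆supp X → (X ∘ₛ Y) ≗ₛ X
  ∘ₛ-absorbˡ {X} {Y} Y⊆X f = compS-absorbˡ (X f) (Y f) (Y⊆X f)

  SameSupp-∘ₛ-comm : ∀ X Y → SameSupp (X ∘ₛ Y) (Y ∘ₛ X)
  SameSupp-∘ₛ-comm X Y = zeros⇒SameSupp (X ∘ₛ Y) (Y ∘ₛ X)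
    (λ f → compS-≡𝟘-comm (X f) (Y f)) (λ f → compS-≡𝟘-comm (Y f) (X f))

  sep-∘ₛ-comm : ∀ X Y → sep (X ∘ₛ Y) (Y ∘ₛ X) ≗ sep X Y
  sep-∘ₛ-comm X Y f = sepS-compS-comm (X f) (Y f)

  ⊕ₛ-noSep : ∀ X Y → (∀ (f : E) → ¬ InSep X Y f) → (X ⊕ₛ Y) ≗ₛ (X ∘ₛ Y)
  ⊕ₛ-noSep X Y X∉Y f = oplusS-noSep (X f) (Y f) (X∉Y f)

  module _ (X Y : SignVec E) where

    SameSupp-∘ₛneg : SameSupp (X ∘ₛ neg Y) (Y ∘ₛ neg X)
    SameSupp-∘ₛneg = zeros⇒SameSupp (X ∘ₛ neg Y) (Y ∘ₛ neg X)
      (λ f → compS-negS-≡𝟘-swap (Y f) (X f))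
      (λ f → compS-negS-≡𝟘-swap (X f) (Y f))

    ⊕ₛ-∘ₛneg : (X ⊕ₛ neg Y) ≗ₛ ((X ∘ₛ neg Y) ⊕ₛ neg (Y ∘ₛ neg X))
    ⊕ₛ-∘ₛneg f = oplusS-negS-compS (X f) (Y f)

    sep-∘ₛneg : sep (X ∘ₛ neg Y) (neg (Y ∘ₛ neg X)) ≗ sep X (neg Y)
    sep-∘ₛneg f = begin
      sepS (compS (X f) (negS (Y f))) (negS (compS (Y f) (negS (X f))))
        ≡⟨ cong (sepS _) (negS-compS-negS (Y f) (X f)) ⟩
      sepS (compS (X f) (negS (Y f))) (compS (negS (Y f)) (X f))
        ≡⟨ sepS-compS-comm (X f) (negS (Y f)) ⟩
      sepS (X f) (negS (Y f)) ∎
      where open ≡-Reasoning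

    sep-neg∘ₛneg : sep (neg (X ∘ₛ neg Y)) (Y ∘ₛ neg X) ≗ sep (neg X) Y
    sep-neg∘ₛneg f = begin
      sepS (negS (compS (X f) (negS (Y f)))) (compS (Y f) (negS (X f)))
        ≡⟨ sepS-negˡ _ _ ⟩
      sepS (compS (X f) (negS (Y f))) (negS (compS (Y f) (negS (X f))))
        ≡⟨ sep-∘ₛneg f ⟩
      sepS (X f) (negS (Y f))
        ≡⟨ sym (sepS-negˡ (X f) (Y f)) ⟩
      sepS (negS (X f)) (Y f) ∎
      where open ≡-Reasoning

module _ {E : Set} (L : SVSet E) where

  -- Iₑ L X Y e and I⁼ₑ L X Y e are definitionally Elim (sep X Y) T e with T = X ∘ₛ Y resp. T = X.
  Elim : (E → Bool) → SignVec E → E → SignVec E → Set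
  Elim σ T e Z = L Z × Z e ≡ 𝟘 × (∀ f → ¬ σ f ≡ true → Z f ≡ T f)

  ElimEmpty : (E → Bool) → SignVec E → Set
  ElimEmpty σ T = ¬ (Σ[ e ∈ E ] Σ[ Z ∈ SignVec E ] (σ e ≡ true × Elim σ T e Z))

  Elim-cong : ∀ {σ σ' T T' e Z} → σ ≗ σ' → T ≗ₛ T' → Elim σ T e Z → Elim σ' T' e Z
  Elim-cong σ≗σ' T≗T' (LZ , Ze≡𝟘 , Z≗T) =
    LZ , Ze≡𝟘 , λ f f∉σ' → trans (Z≗T f (f∉σ' ∘ trans (sym (σ≗σ' f)))) (T≗T' f)

  ElimEmpty-cong : ∀ {σ σ' T T'} → σ ≗ σ' → T ≗ₛ T' → ElimEmpty σ' T' → ElimEmpty σ T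
  ElimEmpty-cong σ≗σ' T≗T' empty (e , Z , e∈σ , Z∈) =
    empty (e , Z , trans (sym (σ≗σ' e)) e∈σ , Elim-cong σ≗σ' T≗T' Z∈)

  Iₑ⇒I⁼ₑ : ∀ X Y {e Z} → Y ⊆supp X → Iₑ L X Y e Z → I⁼ₑ L X Y e Z
  Iₑ⇒I⁼ₑ _ _ Y⊆X = Elim-cong (λ _ → refl) (∘ₛ-absorbˡ Y⊆X)

  I⁼Empty⇒IEmpty : ∀ X Y → Y ⊆supp X → I⁼Empty L X Y → IEmpty L X Y
  I⁼Empty⇒IEmpty _ _ Y⊆X = ElimEmpty-cong (λ _ → refl) (∘ₛ-absorbˡ Y⊆X)

  AxSE⇒¬IEmpty : AxSE L → ∀ {X Y e} → L X → L Y → InSep X Y e → ¬ IEmpty L X Y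
  AxSE⇒¬IEmpty se {X} {Y} {e} LX LY e∈S empty =
    let Z , Z∈ = se X Y LX LY e e∈S in empty (e , Z , e∈S , Z∈)

  AxFS⇒AxC : Extensional L → AxFS L → AxC L
  AxFS⇒AxC ext fs X Y LX LY =
    ext _ _ (λ f → compS-negS-compS (X f) (Y f)) (fs X (X ∘ₛ neg Y) LX (fs X Y LX LY))

  AxSE⇒AxSE⁼ : AxSE L → AxSE⁼ L
  AxSE⇒AxSE⁼ se X Y LX LY X≈Y e e∈S =
    let Z , Z∈ = se X Y LX LY e e∈S in Z , Iₑ⇒I⁼ₑ X Y (proj₂ ∘ X≈Y) Z∈

  AxP⇒AxP⁼asym : AxP L → AxP⁼asym L
  AxP⇒AxP⁼asym p Z W (X , Y , (LX , _) , (LY , _) , X≈Y , I⁼₁ , I⁼₂ , Z≗) =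
    p Z W (X , Y , LX , LY , I⁼Empty⇒IEmpty X (neg Y) (λ f → proj₂ (X≈Y f) ∘ negS-≢𝟘⁻¹) I⁼₁
                           , I⁼Empty⇒IEmpty (neg X) Y (λ f → negS-≢𝟘 ∘ proj₂ (X≈Y f)) I⁼₂ , Z≗)

  -- Since S(X ∘ Y, Y ∘ X) = S(X,Y), the set I⁼_e(X ∘ Y, Y ∘ X) is exactly I_e(X,Y).
  AxSE⁼⇒AxSE : AxC L → AxSE⁼ L → AxSE L
  AxSE⁼⇒AxSE c se⁼ X Y LX LY e e∈S =
    let Z , Z∈ = se⁼ (X ∘ₛ Y) (Y ∘ₛ X) (c X Y LX LY) (c Y X LY LX) (SameSupp-∘ₛ-comm X Y)
                     e (trans (sep-∘ₛ-comm X Y e) e∈S)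
    in Z , Elim-cong (sep-∘ₛ-comm X Y) (λ _ → refl) Z∈

  InP⇒InP⁼asym : AxFS L → AxSE L → ∀ {Z X Y e} → L X → L Y →
    IEmpty L X (neg Y) → IEmpty L (neg X) Y → Z ≗ₛ (X ⊕ₛ neg Y) → InSep X (neg Y) e →
    InP⁼asym L Z
  InP⇒InP⁼asym fs se {Z} {X} {Y} {e} LX LY I₁ I₂ Z≗ e∈S =
    X' , Y' , (LX' , X'-asym) , (LY' , Y'-asym) , SameSupp-∘ₛneg X Y , I⁼₁ , I⁼₂ ,
    λ f → trans (Z≗ f) (⊕ₛ-∘ₛneg X Y f)
    where
    X' Y' : SignVec E
    X' = X ∘ₛ neg Y
    Y' = Y ∘ₛ neg X
    LX' : L X'
    LX' = fs X Y LX LY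
    LY' : L Y'
    LY' = fs Y X LY LX
    I⁼₁ : I⁼Empty L X' (neg Y')
    I⁼₁ = ElimEmpty-cong (sep-∘ₛneg X Y) (λ _ → refl) I₁
    I⁼₂ : I⁼Empty L (neg X') Y'
    I⁼₂ = ElimEmpty-cong (sep-neg∘ₛneg X Y) (λ f → negS-compS-negS (X f) (Y f)) I₂
    X'-asym : ¬ L (neg X')
    X'-asym L-X' = AxSE⇒¬IEmpty se L-X' LY'
      (trans (sep-neg∘ₛneg X Y e) (trans (sepS-negˡ (X e) (Y e)) e∈S))
      (I⁼Empty⇒IEmpty (neg X') Y' (λ f → negS-≢𝟘 ∘ proj₂ (SameSupp-∘ₛneg X Y f)) I⁼₂)
    Y'-asym : ¬ L (neg Y')
    Y'-asym L-Y' = AxSE⇒¬IEmpty se LX' L-Y' (trans (sep-∘ₛneg X Y e) e∈S)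
      (I⁼Empty⇒IEmpty X' (neg Y') (λ f → proj₂ (SameSupp-∘ₛneg X Y f) ∘ negS-≢𝟘⁻¹) I⁼₁)

  AxP⁼asym⇒AxP : ExcludedMiddle 0ℓ → Extensional L → AxC L → AxFS L → AxSE L →
    AxP⁼asym L → AxP L
  AxP⁼asym⇒AxP em ext c fs se p⁼ Z W (X , Y , LX , LY , I₁ , I₂ , Z≗) LW
    with em {∃[ e ] InSep X (neg Y) e}
  ... | yes (e , e∈S) = p⁼ Z W (InP⇒InP⁼asym fs se LX LY I₁ I₂ Z≗ e∈S) LW
  ... | no ∄e = c Z W LZ LW
    where
    LZ : L Z
    LZ = ext _ _ (λ f → sym (trans (Z≗ f) (⊕ₛ-noSep X (neg Y) (λ f' f'∈S → ∄e (f' , f'∈S)) f)))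
                 (fs X Y LX LY)

proposition2p4 : ExcludedMiddle 0ℓ → (E : Set) → (L : SVSet E) → Extensional L →
    (AxC L × AxFS L × AxSE⁼ L × AxP⁼asym L) ⇔ (AxFS L × AxSE L × AxP L)
proposition2p4 em E L ext = mk⇔
  (λ (c , fs , se⁼ , p⁼) → let se = AxSE⁼⇒AxSE L c se⁼ in
    fs , se , AxP⁼asym⇒AxP L em ext c fs se p⁼)
  (λ (fs , se , p) → AxFS⇒AxC L ext fs , fs , AxSE⇒AxSE⁼ L se , AxP⇒AxP⁼asym L p)
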